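{- Let $\mathcal{P}$ be a set of participants, $G$ a bounded global type, $p$ a participant, $P\neq\mathbf{0}$ a process, $N$ a network and $M$ a queue. If $\vdash_{\mathcal{P}} G : p[P]\parallel N\parallel M$ and $p\notin\mathrm{Plays}(G)$, then $\vdash_{\mathcal{P}} G : p[P']\parallel N\parallel M$ for every process $P'$ such that $p\notin\mathrm{plays}(P')$.
   Context: Labels are ranged over by $\lambda$, participants by $p,q,r,s$. Processes are the possibly infinite but regular (finitely many distinct subterms) terms coinductively generated by $P ::= \mathbf{0} \mid q!\{\lambda_i.P_i\}_{i\in I} \mid q?\{\lambda_i.P_i\}_{i\in I}$, with $I$ finite and nonempty and the $\lambda_i$ pairwise distinct (output to $q$, resp. input from $q$, of one of the labels, continuing as $P_i$). $\mathrm{plays}(P)$ is the smallest set with $\mathrm{plays}(\mathbf{0})=\emptyset$ and $\mathrm{plays}(q!\{\lambda_i.P_i\}_{i\in I})=\mathrm{plays}(q?\{\lambda_i.P_i\}_{i\in I})=\{q\}\cup\bigcup_{i\in I}\mathrm{plays}(P_i)$. A message is a triple $(p,\lambda,q)$ (sender $p$, label $\lambda$, receiver $q$). A queue $M$ is a finite sequence of messages ($\emptyset$ empty, $\cdot$ concatenation), taken modulo the equivalence that swaps two adjacent messages $(p,\lambda,q)$ and $(r,\lambda',s)$ whenever $p\neq r$ or $q\neq s$. A network is $N=p_1[P_1]\parallel\cdots\parallel p_n[P_n]$ with the $p_h$ pairwise distinct and $p_h\notin\mathrm{plays}(P_h)$, taken modulo permutation of components and adding/removing components $p[\mathbf{0}]$.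 We write $p[P]\in N$ if $P\neq\mathbf{0}$ and $N\equiv p[P]\parallel N'$ for some $N'$; $\mathrm{Plays}(N)=\{p\mid p[P]\in N\}$. A session is $N\parallel M$. Communications are $pq!\lambda$ and $pq?\lambda$ with $\mathrm{play}(pq!\lambda)=\mathrm{play}(pq?\lambda)=p$. Global types are regular coinductive terms $G ::= pq!\{\lambda_i.G_i\}_{i\in I} \mid pq?\lambda.G \mid \mathsf{End}$ with $p\neq q$, $I$ nonempty, labels pairwise distinct; $pq!\{\lambda_i.G_i\}$ means $p$ sends some $\lambda_i$ to $q$ then $G_i$; $pq?\lambda.G$ means $p$ reads $\lambda$ sent by $q$ then $G$. $\mathrm{Plays}(G)$ is the smallest set with $\mathrm{Plays}(\mathsf{End})=\emptyset$, $\mathrm{Plays}(pq!\{\lambda_i.G_i\}_{i\in I})=\{p\}\cup\bigcup_i\mathrm{Plays}(G_i)$, $\mathrm{Plays}(pq?\lambda.G)=\{p\}\cup\mathrm{Plays}(G)$. $\mathrm{Paths}(G)$ is the greatest set of finite or infinite sequences of communications with $\mathrm{Paths}(\mathsf{End})=\{\epsilon\}$, $\mathrm{Paths}(pq!\{\lambda_i.G_i\}_{i\in I})=\bigcup_{i}\{pq!\lambda_i\cdot\xi\mid\xi\in\mathrm{Paths}(G_i)\}$, $\mathrm{Paths}(pq?\lambda.G)=\{pq?\lambda\cdot\xi\mid \xi\in\mathrm{Paths}(G)\}$; $\xi[n]$ is the $n$-th communication of $\xi$. $\mathrm{depth}(\xi,p)=\inf\{n\mid\mathrm{play}(\xi[n])=p\}$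 (with $\inf\emptyset=\infty$); $\mathrm{depth}(G,p)=\sup\{\mathrm{depth}(\xi,p)\mid\xi\in\mathrm{Paths}(G)\}$ if $p\in\mathrm{Plays}(G)$, and $0$ otherwise. $G$ is bounded if $\mathrm{depth}(G',p)$ is finite for every $p\in\mathrm{Plays}(G)$ and every global type $G'$ occurring in $G$. Weight of a message: $\mathrm{wg}((p,\lambda,q),G)=0$ if $G=qp?\lambda.G'$; $=\infty$ if $G=\mathsf{End}$ or $G=qp?\lambda'.G'$ with $\lambda'\neq\lambda$; $=1+\max_{i\in I}\mathrm{wg}((p,\lambda,q),G_i)$ if $G=rs!\{\lambda_i.G_i\}_{i\in I}$; $=1+\mathrm{wg}((p,\lambda,q),G')$ if $G=rs?\lambda'.G'$ with $r\neq q$ or $s\neq p$. A type configuration $G\parallel M$ is $\mathcal{P}$-sound if $\mathrm{wg}((p,\lambda,q),G)$ is finite for every message $(p,\lambda,q)$ occurring in $M$ with $\{p,q\}\subseteq\mathcal{P}$. A history $H$ is a finite set of pairs $(N\parallel M, G)$; $(N\parallel -,G)\in H$ means $(N\parallel M,G)\in H$ for some $M$; $H,(S,G)$ denotes $H\cup\{(S,G)\}$. Judgements $H\vdash_{\mathcal{P}} G : N\parallel M$ (with $G$ bounded) are derived inductively (finite derivations) by: (End) $H\vdash_{\mathcal{P}}\mathsf{End}:N\parallel M$ if $\mathrm{Plays}(N)\cap\mathcal{P}=\emptyset$ and $\mathsf{End}\parallel M$ is $\mathcal{P}$-sound. (Cycle) $H\vdash_{\mathcal{P}} G:N\parallel M$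 if $(N\parallel M,G)\in H$. (Out) if $G=pq!\{\lambda_i.G_i\}_{i\in I}$, $P=q!\{\lambda_i.P_i\}_{i\in I}$, $G\parallel M$ is $\mathcal{P}$-sound, $(p[P]\parallel N\parallel -,G)\notin H$, $(\mathrm{Plays}(N)\setminus\mathrm{Plays}(G))\cap\mathcal{P}=\emptyset$, and $H,(p[P]\parallel N\parallel M,G)\vdash_{\mathcal{P}} G_i : p[P_i]\parallel N\parallel M\cdot(p,\lambda_i,q)$ for all $i\in I$, then $H\vdash_{\mathcal{P}} G:p[P]\parallel N\parallel M$. (In) if $G=pq?\lambda_h.G'$, $P=q?\{\lambda_i.P_i\}_{i\in I}$ with $h\in I$, $G'\parallel M$ is $\mathcal{P}$-sound, $(p[P]\parallel N\parallel -,G)\notin H$, $(\mathrm{Plays}(N)\setminus\mathrm{Plays}(G))\cap\mathcal{P}=\emptyset$, and $H,(p[P]\parallel N\parallel M,G)\vdash_{\mathcal{P}}G':p[P_h]\parallel N\parallel M$, then $H\vdash_{\mathcal{P}} G : p[P]\parallel N\parallel (q,\lambda_h,p)\cdot M$. We write $\vdash_{\mathcal{P}} G:N\parallel M$ when the judgement is derivable with empty history. -}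

module Defs where

-- Regular (possibly infinite)
-- terms are represented by finite rooted graphs ("systems of equations"):
-- a term is the (coinductive) unfolding of its graph from the root; equality
-- of terms is bisimilarity of the rooted graphs (the greatest relation,
-- given as the union of all post-fixed points).

open import Level using (0ℓ) renaming (suc to lsuc)
open import Data.Nat using (ℕ; zero; suc; _≤_)
open import Data.Nat.Properties using (_≟_)
open import Data.Fin using (Fin)
open import Data.Bool using (if_then_else_)
open import Data.Maybe using (Maybe; just; nothing)
open import Data.List using (List; []; _∷_; _++_; map)
open import Data.List.Membership.Propositional using (_∈_)
open import Data.List.Relation.Unary.Any using (Any)
open import Data.List.Relation.Unary.Unique.Propositional using (Unique)
open import Data.Product using (Σ; ∃; ∃₂; _×_; _,_; proj₁)
open import Data.Sum using (_⊎_)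
open import Data.Unit using (⊤)
open import Data.Empty using (⊥)
open import Function using (_∘_)
open import Relation.Nullary using (¬_; does)
open import Relation.Unary using (Pred)
open import Relation.Binary.PropositionalEquality using (_≡_; _≢_)
open import Relation.Binary.Construct.Closure.Equivalence using (EqClosure)

Participant : Set
Participant = ℕ

Label : Set
Label = ℕ

Branches : Set → Set
Branches X = List (Label × X)

BranchesOK : {X : Set} → Branches X → Set
BranchesOK bs = ¬ (bs ≡ []) × Unique (map proj₁ bs)

BranchRel : {X Y : Set} → (X → Y → Set) → Branches X → Branches Y → Set
BranchRel R bs bs' =
  (∀ l x → (l , x) ∈ bs → ∃ λ y → (l , y) ∈ bs' × R x y) ×
  (∀ l y → (l , y) ∈ bs' → ∃ λ x → (l , x) ∈ bs × R x y)

data PNode (X : Set) : Set where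
  end  : PNode X
  send : Participant → Branches X → PNode X
  recv : Participant → Branches X → PNode X

record Proc : Set where
  constructor proc
  field
    size : ℕ
    node : Fin size → PNode (Fin size)
    root : Fin size
open Proc public

atP : (P : Proc) → Fin (size P) → Proc
atP P s = record P { root = s }

data PChild {X : Set} : PNode X → X → Set where
  c-send : ∀ {q bs l x} → (l , x) ∈ bs → PChild (send q bs) x
  c-recv : ∀ {q bs l x} → (l , x) ∈ bs → PChild (recv q bs) x

-- states reachable from the root (subterms occurring in P)
data PReach (P : Proc) : Fin (size P) → Set where
  r-root : PReach P (root P)
  r-step : ∀ {s t} → PReach P s → PChild (node P s) t → PReach P t

partner : {X : Set} → PNode X → Maybe Participant
partner end        = nothing
partner (send q _) = just q
partner (recv q _) = just q

data PlaysFrom (P : Proc) : Fin (size P) → Participant → Set where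
  pl-here  : ∀ {s r} → partner (node P s) ≡ just r → PlaysFrom P s r
  pl-there : ∀ {s t r} → PChild (node P s) t → PlaysFrom P t r → PlaysFrom P s r

plays : Proc → Participant → Set
plays P r = PlaysFrom P (root P) r

IsZero : Proc → Set
IsZero P = node P (root P) ≡ end

PNodeOK : {X : Set} → PNode X → Set
PNodeOK end         = ⊤
PNodeOK (send _ bs) = BranchesOK bs
PNodeOK (recv _ bs) = BranchesOK bs

IsProcess : Proc → Set
IsProcess P = ∀ s → PReach P s → PNodeOK (node P s)

PNodeRel : {X Y : Set} → (X → Y → Set) → PNode X → PNode Y → Set
PNodeRel R end          end            = ⊤
PNodeRel R (send q bs)  (send q' bs')  = q ≡ q' × BranchRel R bs bs'
PNodeRel R (recv q bs)  (recv q' bs')  = q ≡ q' × BranchRel R bs bs'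
PNodeRel R _            _              = ⊥

_≈P_ : Proc → Proc → Set₁
P ≈P Q = ∃ λ (R : Fin (size P) → Fin (size Q) → Set) →
  R (root P) (root Q) × (∀ s t → R s t → PNodeRel R (node P s) (node Q t))

data GNode (X : Set) : Set where
  End : GNode X
  out : Participant → Participant → Branches X → GNode X
  inp : Participant → Participant → Label → X → GNode X

record GT : Set where
  constructor gt
  field
    gsize : ℕ
    gnode : Fin gsize → GNode (Fin gsize)
    groot : Fin gsize
open GT public

atG : (G : GT) → Fin (gsize G) → GT
atG G s = record G { groot = s }

data GChild {X : Set} : GNode X → X → Set where
  c-out : ∀ {p q bs l x} → (l , x) ∈ bs → GChild (out p q bs) x
  c-inp : ∀ {p q l x} → GChild (inp p q l x) x

data GReach (G : GT) : Fin (gsize G) → Set where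
  r-root : GReach G (groot G)
  r-step : ∀ {s t} → GReach G s → GChild (gnode G s) t → GReach G t

actor : {X : Set} → GNode X → Maybe Participant
actor End           = nothing
actor (out p _ _)   = just p
actor (inp p _ _ _) = just p

data PlaysGFrom (G : GT) : Fin (gsize G) → Participant → Set where
  pl-here  : ∀ {s r} → actor (gnode G s) ≡ just r → PlaysGFrom G s r
  pl-there : ∀ {s t r} → GChild (gnode G s) t → PlaysGFrom G t r → PlaysGFrom G s r

PlaysG : GT → Participant → Set
PlaysG G r = PlaysGFrom G (groot G) r

GNodeOK : {X : Set} → GNode X → Set
GNodeOK End           = ⊤
GNodeOK (out p q bs)  = p ≢ q × BranchesOK bs
GNodeOK (inp p q _ _) = p ≢ q

IsGlobal : GT → Set
IsGlobal G = ∀ s → GReach G s → GNodeOK (gnode G s)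

GNodeRel : {X Y : Set} → (X → Y → Set) → GNode X → GNode Y → Set
GNodeRel R End             End              = ⊤
GNodeRel R (out p q bs)    (out p' q' bs')  = p ≡ p' × q ≡ q' × BranchRel R bs bs'
GNodeRel R (inp p q l x)   (inp p' q' l' y) = p ≡ p' × q ≡ q' × l ≡ l' × R x y
GNodeRel R _               _                = ⊥

_≈G_ : GT → GT → Set₁
G ≈G G' = ∃ λ (R : Fin (gsize G) → Fin (gsize G') → Set) →
  R (groot G) (groot G') × (∀ s t → R s t → GNodeRel R (gnode G s) (gnode G' t))

data Comm : Set where
  cout : Participant → Participant → Label → Comm
  cin  : Participant → Participant → Label → Comm

play : Comm → Participant
play (cout p _ _) = p
play (cin p _ _)  = p

-- finite or infinite sequences of communications: ξ k = nothing means the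
-- sequence has length ≤ k
Seq : Set
Seq = ℕ → Maybe Comm

PathStep : {X : Set} → (X → Seq → Set) → GNode X → Seq → Set
PathStep R End           ξ = ∀ k → ξ k ≡ nothing
PathStep R (out p q bs)  ξ = ∃₂ λ l x → (l , x) ∈ bs × ξ 0 ≡ just (cout p q l) × R x (ξ ∘ suc)
PathStep R (inp p q l x) ξ = ξ 0 ≡ just (cin p q l) × R x (ξ ∘ suc)

-- Paths(G): the greatest set satisfying the equations (union of all
-- post-fixed points)
IsPath : GT → Seq → Set₁
IsPath G ξ = ∃ λ (R : Fin (gsize G) → Seq → Set) →
  R (groot G) ξ × (∀ s ξ' → R s ξ' → PathStep R (gnode G s) ξ')

DepthLe : Participant → Seq → ℕ → Set
DepthLe p ξ n = ∃ λ k → k ≤ n × ∃ λ c → ξ k ≡ just c × play c ≡ p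

-- depth(G,p) is finite (it is 0 when p ∉ Plays(G), the sup otherwise)
DepthFinite : GT → Participant → Set₁
DepthFinite G p = PlaysG G p → ∃ λ n → ∀ ξ → IsPath G ξ → DepthLe p ξ n

Bounded : GT → Set₁
Bounded G = ∀ s → GReach G s → ∀ p → PlaysG G p → DepthFinite (atG G s) p

data Msg : Set where
  msg : Participant → Label → Participant → Msg

Queue : Set
Queue = List Msg

data Swap : Queue → Queue → Set where
  swap : ∀ M₁ M₂ p l q r l' s → (p ≢ r ⊎ q ≢ s) →
         Swap (M₁ ++ msg p l q ∷ msg r l' s ∷ M₂) (M₁ ++ msg r l' s ∷ msg p l q ∷ M₂)

_≈Q_ : Queue → Queue → Set
_≈Q_ = EqClosure Swap

data WgLe (G : GT) (p : Participant) (l : Label) (q : Participant)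
     : Fin (gsize G) → ℕ → Set where
  w-here : ∀ {s s' n} → gnode G s ≡ inp q p l s' → WgLe G p l q s n
  w-out  : ∀ {s r t bs n} → gnode G s ≡ out r t bs →
           (∀ l' s' → (l' , s') ∈ bs → WgLe G p l q s' n) → WgLe G p l q s (suc n)
  w-inp  : ∀ {s r t l' s' n} → gnode G s ≡ inp r t l' s' → (r ≢ q ⊎ t ≢ p) →
           WgLe G p l q s' n → WgLe G p l q s (suc n)

WgFinite : GT → Msg → Set
WgFinite G (msg p l q) = ∃ λ n → WgLe G p l q (groot G) n

Sound : Pred Participant 0ℓ → GT → Queue → Set
Sound 𝒫 G M = ∀ p l q → msg p l q ∈ M → 𝒫 p → 𝒫 q → WgFinite G (msg p l q)

-- Networks (modulo permutation and 0-components: a network is the map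
-- sending each participant to its process, 0 if absent)

Net : Set
Net = Participant → Proc

𝟎 : Proc
𝟎 = proc 1 (λ _ → end) Fin.zero

PlaysN : Net → Participant → Set
PlaysN N r = ¬ IsZero (N r)

WFNet : Net → Set
WFNet N = (∃ λ b → ∀ r → b ≤ r → IsZero (N r)) ×
          (∀ r → IsProcess (N r)) × (∀ r → ¬ plays (N r) r)

-- N [ p ↦ P ]  is  p[P] ∥ N  when p is not a (nonzero) component of N
_[_↦_] : Net → Participant → Proc → Net
(N [ p ↦ P ]) r = if does (r ≟ p) then P else N r

_≈N_ : Net → Net → Set₁
N ≈N N' = ∀ r → N r ≈P N' r

History : Set
History = List (Net × Queue × GT)

InH : Net → Queue → GT → History → Set₁
InH N M G H = Any (λ { (N' , M' , G') → N ≈N N' × M ≈Q M' × G ≈G G' }) H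

InH- : Net → GT → History → Set₁
InH- N G H = Any (λ { (N' , _ , G') → N ≈N N' × G ≈G G' }) H

-- Judge 𝒫 H G N M  stands for  H ⊢_𝒫 G : N ∥ M.
-- In rules (Out)/(In) the network N is  p[P] ∥ N_rest, where P = N p and
-- N_rest is N without p.
data Judge (𝒫 : Pred Participant 0ℓ) : History → GT → Net → Queue → Set₁ where
  t-end   : ∀ {H G N M} → Bounded G →
            gnode G (groot G) ≡ End →
            (∀ r → PlaysN N r → ¬ 𝒫 r) →
            Sound 𝒫 G M →
            Judge 𝒫 H G N M
  t-cycle : ∀ {H G N M} → Bounded G →
            InH N M G H →
            Judge 𝒫 H G N M
  t-out   : ∀ {H G N M p q bG bP} → Bounded G →
            gnode G (groot G) ≡ out p q bG →
            node (N p) (root (N p)) ≡ send q bP →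
            BranchRel (λ _ _ → ⊤) bG bP →
            Sound 𝒫 G M →
            ¬ InH- N G H →
            (∀ r → r ≢ p → PlaysN N r → ¬ PlaysG G r → ¬ 𝒫 r) →
            (∀ l sG sP → (l , sG) ∈ bG → (l , sP) ∈ bP →
               Judge 𝒫 ((N , M , G) ∷ H) (atG G sG)
                     (N [ p ↦ atP (N p) sP ]) (M ++ msg p l q ∷ [])) →
            Judge 𝒫 H G N M
  t-in    : ∀ {H G N M M' p q l sG bP sP} → Bounded G →
            gnode G (groot G) ≡ inp p q l sG →
            node (N p) (root (N p)) ≡ recv q bP →
            (l , sP) ∈ bP →
            Sound 𝒫 (atG G sG) M' →
            ¬ InH- N G H →
            (∀ r → r ≢ p → PlaysN N r → ¬ PlaysG G r → ¬ 𝒫 r) →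
            M ≈Q (msg q l p ∷ M') →
            Judge 𝒫 ((N , M' , G) ∷ H) (atG G sG) (N [ p ↦ atP (N p) sP ]) M' →
            Judge 𝒫 H G N M

{-# OPTIONS --safe #-}
module Submission where

-- The judgement consults the process of a participant only when that participant
-- acts in the global type, when it is compared with the history, and in the side
-- conditions "an active participant outside G is not in 𝒫".  A participant x that
-- does not occur in G never acts; histories built along a derivation for N₁ and for
-- N₂ differ exactly in the x-component; and since the original x-component is
-- nonzero, x is already active before the replacement, so the side conditions
-- already exclude x from 𝒫.  Hence the derivation can be replayed rule by rule.

open import Defs
open import Level using (0ℓ)
open import Data.Fin using (Fin)
open import Data.List using ([]; _∷_; _++_)
open import Data.List.Membership.Propositional using (_∈_)
open import Data.List.Relation.Binary.Pointwise using (Pointwise; []; _∷_)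
open import Data.List.Relation.Unary.Any using (here; there)
open import Data.Nat.Properties using (_≟_)
open import Data.Product using (_×_; _,_)
open import Data.Unit using (⊤)
open import Function using (_∘_)
open import Relation.Binary.PropositionalEquality using (_≡_; _≢_; refl; sym; trans; cong; subst; subst₂)
open import Relation.Nullary using (¬_; yes; no)
open import Relation.Nullary.Decidable using (dec-true; dec-false)
open import Relation.Unary using (Pred)

↦-updates : (N : Net) (p : Participant) (P : Proc) → (N [ p ↦ P ]) p ≡ P
↦-updates N p P rewrite dec-true (p ≟ p) refl = refl

↦-minimal : (N : Net) (p : Participant) (P : Proc) {r : Participant} →
            r ≢ p → (N [ p ↦ P ]) r ≡ N r
↦-minimal N p P {r} r≢p rewrite dec-false (r ≟ p) r≢p = refl

≈P-refl : (P : Proc) → P ≈P P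
≈P-refl P = _≡_ , refl , λ { s .s refl → node-refl (node P s) }
  where
  branches-refl : {X : Set} (bs : Branches X) → BranchRel _≡_ bs bs
  branches-refl bs = (λ _ y y∈bs → y , y∈bs , refl) , (λ _ y y∈bs → y , y∈bs , refl)

  node-refl : (n : PNode (Fin (size P))) → PNodeRel _≡_ n n
  node-refl end         = _
  node-refl (send q bs) = refl , branches-refl bs
  node-refl (recv q bs) = refl , branches-refl bs

PlaysGFrom-atG : ∀ {G s t r} → PlaysGFrom (atG G s) t r → PlaysGFrom G t r
PlaysGFrom-atG (pl-here a≡r)     = pl-here a≡r
PlaysGFrom-atG (pl-there t→u pl) = pl-there t→u (PlaysGFrom-atG pl)

PlaysG-child : ∀ {G n s r} → gnode G (groot G) ≡ n → GChild n s →
               PlaysG (atG G s) r → PlaysG G r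
PlaysG-child refl root→s pl = pl-there root→s (PlaysGFrom-atG pl)

record ReplacedAt (x : Participant) (A B : Proc) (N₁ N₂ : Net) : Set where
  field
    elsewhere : ∀ r → r ≢ x → N₁ r ≡ N₂ r
    before    : N₁ x ≡ A
    after     : N₂ x ≡ B
open ReplacedAt

↦-replacedAt : (N : Net) (x : Participant) (A B : Proc) →
               ReplacedAt x A B (N [ x ↦ A ]) (N [ x ↦ B ])
↦-replacedAt N x A B = record
  { elsewhere = λ r r≢x → trans (↦-minimal N x A r≢x) (sym (↦-minimal N x B r≢x))
  ; before    = ↦-updates N x A
  ; after     = ↦-updates N x B
  }

module _ {x : Participant} where

  ReplacedAt-sym : ∀ {A B N₁ N₂} → ReplacedAt x A B N₁ N₂ → ReplacedAt x B A N₂ N₁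
  ReplacedAt-sym ρ = record
    { elsewhere = λ r r≢x → sym (elsewhere ρ r r≢x) ; before = after ρ ; after = before ρ }

  ReplacedAt-↦ : ∀ {A B N₁ N₂ p} (P : Proc) → p ≢ x → ReplacedAt x A B N₁ N₂ →
                 ReplacedAt x A B (N₁ [ p ↦ P ]) (N₂ [ p ↦ P ])
  ReplacedAt-↦ {N₁ = N₁} {N₂ = N₂} {p = p} P p≢x ρ = record
    { elsewhere = elsewhere′
    ; before    = trans (↦-minimal N₁ p P (p≢x ∘ sym)) (before ρ)
    ; after     = trans (↦-minimal N₂ p P (p≢x ∘ sym)) (after ρ)
    }
    where
    elsewhere′ : ∀ r → r ≢ x → (N₁ [ p ↦ P ]) r ≡ (N₂ [ p ↦ P ]) r
    elsewhere′ r r≢x with r ≟ p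
    ... | yes refl = trans (↦-updates N₁ p P) (sym (↦-updates N₂ p P))
    ... | no  r≢p  rewrite ↦-minimal N₁ p P r≢p | ↦-minimal N₂ p P r≢p = elsewhere ρ r r≢x

  ReplacedAt-≈N : ∀ {A B N₁ N₂ N₁′ N₂′} → ReplacedAt x A B N₁ N₂ → ReplacedAt x A B N₁′ N₂′ →
                  N₁ ≈N N₁′ → N₂ ≈N N₂′
  ReplacedAt-≈N ρ ρ′ N₁≈N₁′ r with r ≟ x
  ... | yes refl = subst₂ _≈P_ (sym (after ρ)) (sym (after ρ′)) (≈P-refl _)
  ... | no  r≢x  = subst₂ _≈P_ (elsewhere ρ r r≢x) (elsewhere ρ′ r r≢x) (N₁≈N₁′ r)

module _ {x : Participant} {A B : Proc} where

  ReplacedAt-PlaysN : ∀ {N₁ N₂} → ¬ IsZero A → ReplacedAt x A B N₁ N₂ →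
                      ∀ {r} → PlaysN N₂ r → PlaysN N₁ r
  ReplacedAt-PlaysN A≢0 ρ {r} r∈N₂ with r ≟ x
  ... | yes refl = A≢0 ∘ subst IsZero (before ρ)
  ... | no  r≢x  = r∈N₂ ∘ subst IsZero (elsewhere ρ r r≢x)

  EntryReplaced : (Net × Queue × GT) → (Net × Queue × GT) → Set
  EntryReplaced (N₁ , M₁ , G₁) (N₂ , M₂ , G₂) = ReplacedAt x A B N₁ N₂ × M₁ ≡ M₂ × G₁ ≡ G₂

  HistoryReplaced : History → History → Set
  HistoryReplaced = Pointwise EntryReplaced

  InH-replaced : ∀ {N₁ N₂ M G H₁ H₂} → ReplacedAt x A B N₁ N₂ → HistoryReplaced H₁ H₂ →
                 InH N₁ M G H₁ → InH N₂ M G H₂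
  InH-replaced ρ ((ρ′ , refl , refl) ∷ _) (here (N≈ , M≈ , G≈)) = here (ReplacedAt-≈N ρ ρ′ N≈ , M≈ , G≈)
  InH-replaced ρ (_ ∷ ρs) (there i) = there (InH-replaced ρ ρs i)

  InH⁻-replaced : ∀ {N₁ N₂ G H₁ H₂} → ReplacedAt x A B N₁ N₂ → HistoryReplaced H₁ H₂ →
                  InH- N₂ G H₂ → InH- N₁ G H₁
  InH⁻-replaced ρ ((ρ′ , refl , refl) ∷ _) (here (N≈ , G≈)) =
    here (ReplacedAt-≈N (ReplacedAt-sym ρ) (ReplacedAt-sym ρ′) N≈ , G≈)
  InH⁻-replaced ρ (_ ∷ ρs) (there i) = there (InH⁻-replaced ρ ρs i)

module _ {𝒫 : Pred Participant 0ℓ} where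

  -- (Out) and (In) with the process at p taken up to equality: the continuations
  -- are indexed by its states, so it cannot be substituted afterwards.
  t-out-via : ∀ {H G N M p q bG} (P : Proc) {bP : Branches (Fin (size P))} → N p ≡ P →
              Bounded G →
              gnode G (groot G) ≡ out p q bG →
              node P (root P) ≡ send q bP →
              BranchRel (λ _ _ → ⊤) bG bP →
              Sound 𝒫 G M →
              ¬ InH- N G H →
              (∀ r → r ≢ p → PlaysN N r → ¬ PlaysG G r → ¬ 𝒫 r) →
              (∀ l sG sP → (l , sG) ∈ bG → (l , sP) ∈ bP →
                 Judge 𝒫 ((N , M , G) ∷ H) (atG G sG) (N [ p ↦ atP P sP ]) (M ++ msg p l q ∷ [])) →
              Judge 𝒫 H G N M
  t-out-via _ refl = t-out

  t-in-via : ∀ {H G N M M′ p q l sG} (P : Proc) {bP : Branches (Fin (size P))} {sP} → N p ≡ P →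
             Bounded G →
             gnode G (groot G) ≡ inp p q l sG →
             node P (root P) ≡ recv q bP →
             (l , sP) ∈ bP →
             Sound 𝒫 (atG G sG) M′ →
             ¬ InH- N G H →
             (∀ r → r ≢ p → PlaysN N r → ¬ PlaysG G r → ¬ 𝒫 r) →
             M ≈Q (msg q l p ∷ M′) →
             Judge 𝒫 ((N , M′ , G) ∷ H) (atG G sG) (N [ p ↦ atP P sP ]) M′ →
             Judge 𝒫 H G N M
  t-in-via _ refl = t-in

  module _ {x : Participant} {A B : Proc} (A≢0 : ¬ IsZero A) where

    Judge-replacedAt : ∀ {H₁ H₂ G N₁ N₂ M} → ReplacedAt x A B N₁ N₂ → HistoryReplaced H₁ H₂ →
                       ¬ PlaysG G x → Judge 𝒫 H₁ G N₁ M → Judge 𝒫 H₂ G N₂ M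
    Judge-replacedAt ρ ρs x∉G (t-end b root≡End outside sound) =
      t-end b root≡End (λ r → outside r ∘ ReplacedAt-PlaysN A≢0 ρ) sound
    Judge-replacedAt ρ ρs x∉G (t-cycle b seen) =
      t-cycle b (InH-replaced ρ ρs seen)
    Judge-replacedAt {N₁ = N₁} ρ ρs x∉G
      (t-out {p = p} b root≡out P≡send br sound fresh outside next) =
      t-out-via (N₁ p) (sym (elsewhere ρ p p≢x)) b root≡out P≡send br sound
        (fresh ∘ InH⁻-replaced ρ ρs)
        (λ r r≢p → outside r r≢p ∘ ReplacedAt-PlaysN A≢0 ρ)
        (λ l sG sP l∈bG l∈bP →
          Judge-replacedAt (ReplacedAt-↦ _ p≢x ρ) ((ρ , refl , refl) ∷ ρs)
            (x∉G ∘ PlaysG-child root≡out (c-out l∈bG)) (next l sG sP l∈bG l∈bP))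
      where
      p≢x : p ≢ x
      p≢x refl = x∉G (pl-here (cong actor root≡out))
    Judge-replacedAt {N₁ = N₁} ρ ρs x∉G
      (t-in {p = p} b root≡inp P≡recv l∈bP sound fresh outside M≈ next) =
      t-in-via (N₁ p) (sym (elsewhere ρ p p≢x)) b root≡inp P≡recv l∈bP sound
        (fresh ∘ InH⁻-replaced ρ ρs)
        (λ r r≢p → outside r r≢p ∘ ReplacedAt-PlaysN A≢0 ρ)
        M≈
        (Judge-replacedAt (ReplacedAt-↦ _ p≢x ρ) ((ρ , refl , refl) ∷ ρs)
          (x∉G ∘ PlaysG-child root≡inp c-inp) next)
      where
      p≢x : p ≢ x
      p≢x refl = x∉G (pl-here (cong actor root≡inp))

lemma3 : (𝒫 : Pred Participant 0ℓ) (G : GT) (p : Participant) (P : Proc) (N : Net) (M : Queue) →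
    IsGlobal G → Bounded G →
    IsProcess P → ¬ IsZero P → ¬ plays P p →
    WFNet N → IsZero (N p) →
    Judge 𝒫 [] G (N [ p ↦ P ]) M →
    ¬ PlaysG G p →
    (P' : Proc) → IsProcess P' → ¬ plays P' p →
    Judge 𝒫 [] G (N [ p ↦ P' ]) M
lemma3 𝒫 G p P N M _ _ _ P≢0 _ _ _ ⊢G p∉G P' _ _ =
  Judge-replacedAt P≢0 (↦-replacedAt N p P P') [] p∉G ⊢G
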